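{- Let $G=(V,E)$ be a simple graph and $X\subseteq E$ a non-empty set of edges such that $G[X]$ is not a star graph. Then $\mathrm{OPT} \ge \tau(G[X])$, where $\mathrm{OPT}$ is the minimum length of a cycle (not necessarily simple) of $G$ that covers $X$.
   Context: A cycle (not necessarily simple) is a closed walk in $G$, possibly a single vertex (length $0$); its length is the number of edges counting repetitions. A cycle covers $X$ if every edge of $X$ has an endpoint among the cycle's vertices. $G[X]$ is the subgraph of $G$ induced by the edge set $X$ (edges $X$ and their endpoints). $\tau(H)$ is the cardinality of a minimum vertex cover of $H$. A star graph is a complete bipartite graph $K_{1,n}$ for some $n\ge 1$. -}

module Defs where

open import Data.Nat using (ℕ; zero; suc; _≤_)
open import Data.Fin using (Fin; zero; suc; inject₁; fromℕ)
open import Data.Fin.Subset using (Subset; _∈_; ∣_∣)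
open import Data.Product using (Σ; _×_; _,_; ∃; ∃-syntax)
open import Data.Sum using (_⊎_)
open import Relation.Nullary using (¬_)
open import Relation.Binary.PropositionalEquality using (_≡_)

record SimpleGraph (n : ℕ) : Set₁ where
  field
    Adj       : Fin n → Fin n → Set
    symmetric : ∀ {u v} → Adj u v → Adj v u
    loopless  : ∀ {u} → ¬ Adj u u
open SimpleGraph public

-- A set of edges X ⊆ E(G), given as a symmetric relation contained in Adj
-- (an undirected edge {u,v} is in X iff X u v, iff X v u).
record EdgeSubset {n : ℕ} (G : SimpleGraph n) : Set₁ where
  field
    Mem       : Fin n → Fin n → Set
    symmetric : ∀ {u v} → Mem u v → Mem v u
    ⊆E        : ∀ {u v} → Mem u v → Adj G u v
open EdgeSubset public

module _ {n : ℕ} {G : SimpleGraph n} (X : EdgeSubset G) where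

  NonEmpty : Set
  NonEmpty = ∃[ u ] ∃[ v ] Mem X u v

  -- G[X] (edges X with their endpoints) is a star K_{1,m}, m ≥ 1:
  -- it has an edge, and there is a centre c lying on every edge of X.
  IsStar : Set
  IsStar = NonEmpty × (∃[ c ] (∀ u v → Mem X u v → (u ≡ c ⊎ v ≡ c)))

  IsVertexCover : Subset n → Set
  IsVertexCover C = ∀ u v → Mem X u v → (u ∈ C ⊎ v ∈ C)

  IsTau : ℕ → Set
  IsTau k = (∃[ C ] (IsVertexCover C × ∣ C ∣ ≡ k))
          × (∀ C → IsVertexCover C → k ≤ ∣ C ∣)

-- A closed walk of length k in G: vertices w 0, w 1, …, w k with
-- consecutive vertices adjacent and w k = w 0.  (k = 0: a single vertex.)
record ClosedWalk {n : ℕ} (G : SimpleGraph n) (k : ℕ) : Set where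
  field
    vert   : Fin (suc k) → Fin n
    step   : ∀ (i : Fin k) → Adj G (vert (inject₁ i)) (vert (suc i))
    closed : vert (fromℕ k) ≡ vert zero
open ClosedWalk public

Covers : {n k : ℕ} {G : SimpleGraph n} → ClosedWalk G k → EdgeSubset G → Set
Covers {n} {k} W X =
  ∀ u v → Mem X u v → (∃[ i ] vert W i ≡ u) ⊎ (∃[ i ] vert W i ≡ v)

module Submission where

-- Let W be a closed walk of length k covering X.
--   * If k = 0, the walk is a single vertex c, and "W covers X" says that
--     every edge of X contains c; since X is non-empty, G[X] is a star,
--     contradicting the hypothesis.
--   * If k ≥ 1, closedness (w k = w 0) means the vertices of W are exactly
--     w 0, …, w (k-1), so they form a set of at most k vertices.  As W covers
--     X, this set is a vertex cover of G[X], hence τ(G[X]) ≤ k.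

open import Defs
open import Data.Nat using (ℕ; zero; suc; _+_; _≤_; z≤n; s≤s)
open import Data.Nat.Properties using (≤-trans; +-suc; m≤n⇒m≤1+n; module ≤-Reasoning)
open import Data.Fin using (Fin; zero; suc; inject₁; fromℕ)
open import Data.Fin.Subset using (Subset; _∈_; ∣_∣; ⊥; ⁅_⁆; _∪_)
open import Data.Fin.Subset.Properties using (x∈⁅x⁆; x∈p∪q⁺; ∣⊥∣≡0; ∣⁅x⁆∣≡1)
open import Data.Vec using ([]; _∷_)
open import Data.Bool using (true; false)
open import Data.Product using (_,_; ∃-syntax)
open import Data.Sum using (_⊎_; inj₁; inj₂)
open import Data.Empty using (⊥-elim)
open import Relation.Nullary using (¬_)
open import Relation.Binary.PropositionalEquality
  using (_≡_; refl; sym; trans; subst; cong)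

∣p∪q∣≤∣p∣+∣q∣ : ∀ {n} (p q : Subset n) → ∣ p ∪ q ∣ ≤ ∣ p ∣ + ∣ q ∣
∣p∪q∣≤∣p∣+∣q∣ []          []          = z≤n
∣p∪q∣≤∣p∣+∣q∣ (true ∷ p)  (true ∷ q)
  rewrite +-suc ∣ p ∣ ∣ q ∣ = s≤s (m≤n⇒m≤1+n (∣p∪q∣≤∣p∣+∣q∣ p q))
∣p∪q∣≤∣p∣+∣q∣ (true ∷ p)  (false ∷ q) = s≤s (∣p∪q∣≤∣p∣+∣q∣ p q)
∣p∪q∣≤∣p∣+∣q∣ (false ∷ p) (true ∷ q)
  rewrite +-suc ∣ p ∣ ∣ q ∣ = s≤s (∣p∪q∣≤∣p∣+∣q∣ p q)
∣p∪q∣≤∣p∣+∣q∣ (false ∷ p) (false ∷ q) = ∣p∪q∣≤∣p∣+∣q∣ p q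

image : ∀ {n} k → (Fin k → Fin n) → Subset n
image zero    f = ⊥
image (suc k) f = ⁅ f zero ⁆ ∪ image k (λ i → f (suc i))

∣image∣≤k : ∀ {n} k (f : Fin k → Fin n) → ∣ image k f ∣ ≤ k
∣image∣≤k {n} zero f = subst (_≤ 0) (sym (∣⊥∣≡0 n)) z≤n
∣image∣≤k (suc k) f = begin
  ∣ ⁅ f zero ⁆ ∪ rest ∣    ≤⟨ ∣p∪q∣≤∣p∣+∣q∣ ⁅ f zero ⁆ rest ⟩
  ∣ ⁅ f zero ⁆ ∣ + ∣ rest ∣ ≡⟨ cong (_+ ∣ rest ∣) (∣⁅x⁆∣≡1 (f zero)) ⟩
  suc ∣ rest ∣              ≤⟨ s≤s (∣image∣≤k k (λ i → f (suc i))) ⟩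
  suc k                     ∎
  where
  open ≤-Reasoning
  rest = image k (λ i → f (suc i))

∈-image : ∀ {n} k (f : Fin k → Fin n) i → f i ∈ image k f
∈-image (suc k) f zero    = x∈p∪q⁺ (inj₁ (x∈⁅x⁆ (f zero)))
∈-image (suc k) f (suc i) = x∈p∪q⁺ (inj₂ (∈-image k (λ j → f (suc j)) i))

last-or-inject₁ : ∀ k (i : Fin (suc k)) → i ≡ fromℕ k ⊎ ∃[ j ] i ≡ inject₁ j
last-or-inject₁ zero    zero    = inj₁ refl
last-or-inject₁ (suc k) zero    = inj₂ (zero , refl)
last-or-inject₁ (suc k) (suc i) with last-or-inject₁ k i
... | inj₁ e       = inj₁ (cong suc e)
... | inj₂ (j , e) = inj₂ (suc j , cong suc e)

module _ {n : ℕ} {G : SimpleGraph n} where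

  initialVertices : ∀ {k} → ClosedWalk G k → Fin k → Fin n
  initialVertices W j = vert W (inject₁ j)

  -- The vertex set of a closed walk: since w k = w 0, it is the image of
  -- the first k vertices.
  walkVertices : ∀ {k} → ClosedWalk G k → Subset n
  walkVertices {k} W = image k (initialVertices W)

  ∣walkVertices∣≤k : ∀ {k} (W : ClosedWalk G k) → ∣ walkVertices W ∣ ≤ k
  ∣walkVertices∣≤k {k} W = ∣image∣≤k k (initialVertices W)

  -- For positive length every vertex of the walk is in walkVertices; the
  -- last one because it equals the first (closedness).
  ∈-walkVertices : ∀ {k} (W : ClosedWalk G (suc k)) i → vert W i ∈ walkVertices W
  ∈-walkVertices {k} W i with last-or-inject₁ (suc k) i
  ... | inj₁ e       = subst (_∈ walkVertices W)
                         (sym (trans (cong (vert W) e) (closed W)))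
                         (∈-image (suc k) (initialVertices W) zero)
  ... | inj₂ (j , e) = subst (_∈ walkVertices W) (sym (cong (vert W) e))
                         (∈-image (suc k) (initialVertices W) j)

  covering-walk⇒vertexCover : ∀ {k} (W : ClosedWalk G k) (X : EdgeSubset G) →
    Covers W X → (C : Subset n) → (∀ i → vert W i ∈ C) → IsVertexCover X C
  covering-walk⇒vertexCover W X cov C onWalk u v uv with cov u v uv
  ... | inj₁ (i , e) = inj₁ (subst (_∈ C) e (onWalk i))
  ... | inj₂ (i , e) = inj₂ (subst (_∈ C) e (onWalk i))

  covering-trivial-walk⇒star : (W : ClosedWalk G 0) (X : EdgeSubset G) →
    NonEmpty X → Covers W X → IsStar X
  covering-trivial-walk⇒star W X ne cov = ne , vert W zero , centre
    where
    centre : ∀ u v → Mem X u v → (u ≡ vert W zero ⊎ v ≡ vert W zero)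
    centre u v uv with cov u v uv
    ... | inj₁ (zero , e) = inj₁ (sym e)
    ... | inj₂ (zero , e) = inj₂ (sym e)

lemma1 : {n : ℕ} (G : SimpleGraph n) (X : EdgeSubset G) →
    NonEmpty X → ¬ IsStar X →
    ∀ (k : ℕ) (W : ClosedWalk G k) → Covers W X →
    ∀ (t : ℕ) → IsTau X t → t ≤ k
lemma1 G X ne notStar zero W cov t _ =
  ⊥-elim (notStar (covering-trivial-walk⇒star W X ne cov))
lemma1 G X ne notStar (suc k) W cov t (_ , minimal) =
  ≤-trans (minimal (walkVertices W) cover) (∣walkVertices∣≤k W)
  where
  cover : IsVertexCover X (walkVertices W)
  cover = covering-walk⇒vertexCover W X cov (walkVertices W) (∈-walkVertices W)
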